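{- Let $\Gamma$ be a commutative thick weakly distance-regular digraph. If D$(q)$ exists, then $\Gamma_{1,q-1}^{2}=\{\Gamma_{2,q-2}\}$ or $\Gamma_{1,q-1}^{2}=\{\Gamma_{2,q-1}\}$.
   Context: All digraphs are finite, simple, strongly connected. $\partial(x,y)$ is the directed distance, $\tilde\partial(x,y)=(\partial(x,y),\partial(y,x))$, $\tilde\partial(\Gamma)$ the set of all such pairs; $\Gamma_{a,b}=\{(x,y)\mid\tilde\partial(x,y)=(a,b)\}$, $\Gamma_{a,b}(x)=\{y\mid(x,y)\in\Gamma_{a,b}\}$. Weakly distance-regular: for $\tilde h,\tilde i,\tilde j\in\tilde\partial(\Gamma)$, the number $p^{\tilde h}_{\tilde i,\tilde j}$ of $z$ with $\tilde\partial(x,z)=\tilde i,\tilde\partial(z,y)=\tilde j$ depends only on $\tilde h=\tilde\partial(x,y)$ (taken as $0$ if a pair is outside $\tilde\partial(\Gamma)$); commutative: $p^{\tilde h}_{\tilde i,\tilde j}=p^{\tilde h}_{\tilde j,\tilde i}$; $k_{\tilde i}=|\Gamma_{\tilde i}(x)|$; thick: $p^{\tilde h}_{\tilde i,\tilde i},p^{\tilde h}_{\tilde i,\tilde i^*}\in\{0,k_{\tilde i}\}$ with $(a,b)^*=(b,a)$. With $R=\{\Gamma_{\tilde i}\}$ and nonempty $E,F\subseteq R$, $EF=\{\Gamma_{\tilde h}\mid\sum_{\Gamma_{\tilde i}\in E}\sum_{\Gamma_{\tilde j}\in F}p^{\tilde h}_{\tilde i,\tilde j}\neq0\}$; a single relation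 is identified with its singleton and $\Gamma_{\tilde i}^2=\Gamma_{\tilde i}\Gamma_{\tilde i}$. An arc $(u,v)$ is of type $(1,q-1)$ if $\partial(v,u)=q-1$; it is pure if every circuit (closed directed walk) of length $q$ containing it consists of arcs of type $(1,q-1)$; $(1,q-1)$ is pure if every such arc is pure. D$(q)$ exists if $p^{(1,q-1)}_{(1,q-2),(q-2,1)}\ne0$ and $(1,q-2)$ is pure. -}

module Defs where

open import Data.Nat using (ℕ; zero; suc; _+_; _∸_; _<_)
open import Data.Nat.Properties using () renaming (_≟_ to _≟ℕ_)
open import Data.Bool using (Bool; true; false; _∧_; if_then_else_)
open import Data.Fin using (Fin) renaming (_≟_ to _≟F_)
open import Data.List using (List; []; _∷_; map; allFin; cartesianProduct)
open import Data.Bool.ListAction using (any)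
open import Data.Nat.ListAction using (sum)
open import Data.Product using (_×_; _,_; Σ; ∃)
open import Data.Product.Properties using (≡-dec)
open import Data.Sum using (_⊎_)
open import Relation.Nullary using (¬_)
open import Relation.Nullary.Decidable using (⌊_⌋)
open import Relation.Binary.PropositionalEquality using (_≡_; _≢_)
open import Function.Bundles using (_⇔_)

-- least k < m with f k ≡ true, or m if there is none
firstTrue : (ℕ → Bool) → ℕ → ℕ
firstTrue f zero = zero
firstTrue f (suc m) = if f zero then zero else suc (firstTrue (λ k → f (suc k)) m)

module Digraph {n : ℕ} (A : Fin n → Fin n → Bool) where

  Vertex : Set
  Vertex = Fin n

  walk : ℕ → Vertex → Vertex → Bool
  walk zero x y = ⌊ x ≟F y ⌋
  walk (suc k) x y = any (λ z → A x z ∧ walk k z y) (allFin n)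

  -- directed distance (for strongly connected digraphs it is < n)
  ∂ : Vertex → Vertex → ℕ
  ∂ x y = firstTrue (λ k → walk k x y) n

  ∂̃ : Vertex → Vertex → ℕ × ℕ
  ∂̃ x y = (∂ x y , ∂ y x)

  _* : ℕ × ℕ → ℕ × ℕ
  (a , b) * = (b , a)

  _=ᵖ_ : ℕ × ℕ → ℕ × ℕ → Bool
  i =ᵖ j = ⌊ ≡-dec _≟ℕ_ _≟ℕ_ i j ⌋

  count : (Vertex → Bool) → ℕ
  count P = sum (map (λ z → if P z then 1 else 0) (allFin n))

  kAt : Vertex → ℕ × ℕ → ℕ
  kAt x i = count (λ z → ∂̃ x z =ᵖ i)

  cnt : Vertex → Vertex → ℕ × ℕ → ℕ × ℕ → ℕ
  cnt x y i j = count (λ z → (∂̃ x z =ᵖ i) ∧ (∂̃ z y =ᵖ j))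

  pAux : ℕ × ℕ → ℕ × ℕ → ℕ × ℕ → List (Vertex × Vertex) → ℕ
  pAux h i j [] = 0
  pAux h i j ((x , y) ∷ ps) = if ∂̃ x y =ᵖ h then cnt x y i j else pAux h i j ps

  -- intersection number p^h_{i,j}: evaluated at the first pair (x,y) with
  -- ∂̃(x,y) = h, and 0 if h ∉ ∂̃(Γ)
  p : ℕ × ℕ → ℕ × ℕ → ℕ × ℕ → ℕ
  p h i j = pAux h i j (cartesianProduct (allFin n) (allFin n))

  Simple : Set
  Simple = ∀ x → A x x ≡ false

  StronglyConnected : Set
  StronglyConnected = ∀ x y → ∃ λ k → walk k x y ≡ true

  WeaklyDistanceRegular : Set
  WeaklyDistanceRegular =
    ∀ x y x′ y′ → ∂̃ x y ≡ ∂̃ x′ y′ → ∀ i j → cnt x y i j ≡ cnt x′ y′ i j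

  Commutative : Set
  Commutative = ∀ h i j → p h i j ≡ p h j i

  Thick : Set
  Thick = ∀ x h i →
    (p h i i ≡ 0 ⊎ p h i i ≡ kAt x i) × (p h i (i *) ≡ 0 ⊎ p h i (i *) ≡ kAt x i)

  IsCircuit : ℕ → (ℕ → Vertex) → Set
  IsCircuit L c = (c L ≡ c 0) × (∀ i → i < L → A (c i) (c (suc i)) ≡ true)

  ArcOfType : ℕ → Vertex → Vertex → Set
  ArcOfType q u v = (A u v ≡ true) × (∂ v u ≡ q ∸ 1)

  PureArc : ℕ → Vertex → Vertex → Set
  PureArc q u v = ∀ c → IsCircuit q c →
    (Σ ℕ λ i → (i < q) × (c i ≡ u) × (c (suc i) ≡ v)) →
    ∀ i → i < q → ArcOfType q (c i) (c (suc i))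

  PureType : ℕ → Set
  PureType q = ∀ u v → ArcOfType q u v → PureArc q u v

  D : ℕ → Set
  D q = (p (1 , q ∸ 1) (1 , q ∸ 2) (q ∸ 2 , 1) ≢ 0) × PureType (q ∸ 1)

  SquareIs : ℕ × ℕ → ℕ × ℕ → Set
  SquareIs i t = ∀ h → (p h i i ≢ 0) ⇔ (h ≡ t)

module Submission where

-- Write i = (1,q-1) and j = (1,q-2). Since p^i_{j,j*} ≠ 0, thickness gives p^i_{j,j*} = k_j, so
-- Γ_j(x) ⊆ Γ_j(y) whenever ∂̃(x,y) = i. For a path x → y → w of two i-arcs this bounds ∂(w,x)
-- by q-1 through a common j-neighbour, and ∂(w,x) ≥ q-2 by the triangle inequality. Moreover
-- ∂(x,w) ≠ 1: ∂̃(x,w) = j would give ∂̃(y,w) = j, and ∂̃(x,w) = i would make p^i_{i,i} = k_i by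
-- thickness, putting y in Γ_i(y). So ∂̃(x,w) is (2,q-2) or (2,q-1).
-- If Γ_{2,q-2} ∈ Γ_i², thickness of p^{(2,q-2)}_{i,i} forces ∂(w,x) ≤ q-2 for every such path,
-- so Γ_i² = {Γ_{2,q-2}}; otherwise no path has type (2,q-2) and Γ_i² = {Γ_{2,q-1}}.

open import Defs
open import Data.Nat using (ℕ; zero; suc; _+_; _∸_; _≤_; _<_; z≤n; s≤s; s≤s⁻¹; _≟_)
open import Data.Nat.Properties
open import Data.Nat.ListAction using (sum)
open import Data.Bool using (Bool; true; false; _∧_; if_then_else_)
open import Data.Bool.Properties using (T-≡; T-∧)
open import Data.Fin using (Fin)
open import Data.Fin.Properties using (toℕ<n)
open import Data.List using (List; []; _∷_; map; allFin; cartesianProduct)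
open import Data.List.Relation.Unary.Any using (here; there; satisfied)
open import Data.List.Relation.Unary.Any.Properties using (any⁺; any⁻)
open import Data.List.Membership.Propositional using (_∈_; lose)
open import Data.List.Membership.Propositional.Properties using (∈-allFin; ∈-cartesianProduct⁺)
open import Data.Product using (_×_; _,_; proj₁; proj₂; ∃; ∃-syntax)
open import Data.Sum using (_⊎_; inj₁; inj₂)
open import Data.Empty using (⊥-elim)
open import Function using (_∘_)
open import Function.Bundles using (Equivalence; mk⇔)
open import Relation.Nullary using (yes; no)
open import Relation.Nullary.Decidable using (toWitness; fromWitness)
open import Relation.Binary.PropositionalEquality
  using (_≡_; _≢_; refl; sym; trans; cong; cong₂; subst)

module IndicatorSum {X : Set} where

  indicatorSum : (X → Bool) → List X → ℕ
  indicatorSum P L = sum (map (λ z → if P z then 1 else 0) L)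

  indicatorSum≢0⇒∃ : ∀ (P : X → Bool) L → indicatorSum P L ≢ 0 → ∃[ z ] P z ≡ true
  indicatorSum≢0⇒∃ P []      s≢0 = ⊥-elim (s≢0 refl)
  indicatorSum≢0⇒∃ P (x ∷ L) s≢0 with P x in Px
  ... | true  = x , Px
  ... | false = indicatorSum≢0⇒∃ P L s≢0

  ∈⇒indicatorSum≢0 : ∀ (P : X → Bool) L {z} → z ∈ L → P z ≡ true → indicatorSum P L ≢ 0
  ∈⇒indicatorSum≢0 P (x ∷ L) (here refl) Pz rewrite Pz = λ ()
  ∈⇒indicatorSum≢0 P (x ∷ L) (there z∈L) Pz with P x
  ... | true  = λ ()
  ... | false = ∈⇒indicatorSum≢0 P L z∈L Pz

  indicator-∧-≤ : ∀ b c → (if b ∧ c then 1 else 0) ≤ (if b then 1 else 0)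
  indicator-∧-≤ true  true  = ≤-refl
  indicator-∧-≤ true  false = z≤n
  indicator-∧-≤ false c     = z≤n

  indicatorSum-∧-≤ : ∀ (P Q : X → Bool) L → indicatorSum (λ z → P z ∧ Q z) L ≤ indicatorSum P L
  indicatorSum-∧-≤ P Q []      = z≤n
  indicatorSum-∧-≤ P Q (x ∷ L) = +-mono-≤ (indicator-∧-≤ (P x) (Q x)) (indicatorSum-∧-≤ P Q L)

  indicatorSum-∧-< : ∀ (P Q : X → Bool) L {z} → z ∈ L → P z ≡ true → Q z ≡ false →
                     indicatorSum (λ z → P z ∧ Q z) L < indicatorSum P L
  indicatorSum-∧-< P Q (x ∷ L) (here refl) Pz Qz rewrite Pz | Qz =
    s≤s (indicatorSum-∧-≤ P Q L)
  indicatorSum-∧-< P Q (x ∷ L) (there z∈L) Pz Qz =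
    +-mono-≤-< (indicator-∧-≤ (P x) (Q x)) (indicatorSum-∧-< P Q L z∈L Pz Qz)

  indicatorSum-∧-≡⇒ : ∀ (P Q : X → Bool) L → indicatorSum (λ z → P z ∧ Q z) L ≡ indicatorSum P L →
                      ∀ {z} → z ∈ L → P z ≡ true → Q z ≡ true
  indicatorSum-∧-≡⇒ P Q L s≡ {z} z∈L Pz with Q z in Qz
  ... | true  = refl
  ... | false = ⊥-elim (<-irrefl s≡ (indicatorSum-∧-< P Q L z∈L Pz Qz))

module FirstTrue where

  firstTrue-≤ : ∀ f m → firstTrue f m ≤ m
  firstTrue-≤ f zero = z≤n
  firstTrue-≤ f (suc m) with f zero
  ... | true  = z≤n
  ... | false = s≤s (firstTrue-≤ (f ∘ suc) m)

  firstTrue-minimal : ∀ f m k → f k ≡ true → firstTrue f m ≤ k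
  firstTrue-minimal f zero    k       fk = z≤n
  firstTrue-minimal f (suc m) k       fk with f zero in f0
  firstTrue-minimal f (suc m) k       fk | true  = z≤n
  firstTrue-minimal f (suc m) zero    fk | false with trans (sym f0) fk
  ... | ()
  firstTrue-minimal f (suc m) (suc k) fk | false = s≤s (firstTrue-minimal (f ∘ suc) m k fk)

  firstTrue-true : ∀ f m → firstTrue f m < m → f (firstTrue f m) ≡ true
  firstTrue-true f (suc m) ft<m with f zero in f0
  ... | true  = f0
  ... | false = firstTrue-true (f ∘ suc) m (s≤s⁻¹ ft<m)

open IndicatorSum
open FirstTrue

module DigraphProperties {n : ℕ} (A : Fin n → Fin n → Bool) where
  open Digraph A

  private
    variable
      x y z : Vertex
      k l m : ℕ
      h i j : ℕ × ℕ

  =ᵖ⇒≡ : h =ᵖ i ≡ true → h ≡ i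
  =ᵖ⇒≡ = toWitness ∘ Equivalence.from T-≡

  ≡⇒=ᵖ : h ≡ i → h =ᵖ i ≡ true
  ≡⇒=ᵖ = Equivalence.to T-≡ ∘ fromWitness

  walk-zero⁻ : walk 0 x y ≡ true → x ≡ y
  walk-zero⁻ = toWitness ∘ Equivalence.from T-≡

  walk-zero⁺ : walk 0 x x ≡ true
  walk-zero⁺ = Equivalence.to T-≡ (fromWitness refl)

  walk-suc⁻ : ∀ k → walk (suc k) x y ≡ true → ∃[ z ] A x z ≡ true × walk k z y ≡ true
  walk-suc⁻ {x} {y} k e
    with z , t ← satisfied (any⁻ (λ z → A x z ∧ walk k z y) (allFin n) (Equivalence.from T-≡ e))
    with a , b ← Equivalence.to T-∧ t
    = z , Equivalence.to T-≡ a , Equivalence.to T-≡ b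

  walk-suc⁺ : ∀ k → A x z ≡ true → walk k z y ≡ true → walk (suc k) x y ≡ true
  walk-suc⁺ {x} {z} {y} k a b = Equivalence.to T-≡
    (any⁺ (λ z → A x z ∧ walk k z y)
      (lose (∈-allFin z) (Equivalence.from T-∧ (Equivalence.from T-≡ a , Equivalence.from T-≡ b))))

  walk-++ : ∀ k l → walk k x y ≡ true → walk l y z ≡ true → walk (k + l) x z ≡ true
  walk-++ zero    l e₁ e₂ rewrite walk-zero⁻ e₁ = e₂
  walk-++ (suc k) l e₁ e₂ with u , a , e ← walk-suc⁻ k e₁ = walk-suc⁺ (k + l) a (walk-++ k l e e₂)

  ∂-≤-bound : ∂ x y ≤ n
  ∂-≤-bound {x} {y} = firstTrue-≤ (λ k → walk k x y) n

  ∂-minimal : ∀ k → walk k x y ≡ true → ∂ x y ≤ k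
  ∂-minimal {x} {y} k = firstTrue-minimal (λ k → walk k x y) n k

  ∂-walk : ∂ x y < n → walk (∂ x y) x y ≡ true
  ∂-walk {x} {y} = firstTrue-true (λ k → walk k x y) n

  ∂-refl : ∂ x x ≡ 0
  ∂-refl = n≤0⇒n≡0 (∂-minimal 0 walk-zero⁺)

  ∂≡0⇒≡ : ∂ x y ≡ 0 → x ≡ y
  ∂≡0⇒≡ {x} {y} ∂≡0 = walk-zero⁻ (subst (λ k → walk k x y ≡ true) ∂≡0 (∂-walk ∂<n))
    where
    ∂<n : ∂ x y < n
    ∂<n = subst (_< n) (sym ∂≡0) (≤-trans (s≤s z≤n) (toℕ<n x))

  ∂≡suc⇒≢ : ∂ x y ≡ suc m → x ≢ y
  ∂≡suc⇒≢ ∂≡suc refl = 1+n≢0 (trans (sym ∂≡suc) ∂-refl)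

  -- ∂ x y = n when there is no walk shorter than n; the inequality holds in that case too.
  ∂-triangle : ∀ x y z → ∂ x z ≤ ∂ x y + ∂ y z
  ∂-triangle x y z with ∂ x y <? n | ∂ y z <? n
  ... | yes xy<n | yes yz<n = ∂-minimal _ (walk-++ (∂ x y) (∂ y z) (∂-walk xy<n) (∂-walk yz<n))
  ... | no  xy≮n | _        = ≤-trans ∂-≤-bound (≤-trans (≮⇒≥ xy≮n) (m≤m+n _ _))
  ... | yes _    | no yz≮n  = ≤-trans ∂-≤-bound (≤-trans (≮⇒≥ yz≮n) (m≤n+m _ _))

  ∂-geodesic : ∂ x y ≡ suc m → ∂ x y < n → ∃[ u ] ∂ x u ≤ 1 × ∂ u y ≤ m
  ∂-geodesic {x} {y} {m} ∂≡suc ∂<n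
    with u , a , e ← walk-suc⁻ m (subst (λ k → walk k x y ≡ true) ∂≡suc (∂-walk ∂<n))
    = u , ∂-minimal 1 (walk-suc⁺ 0 a walk-zero⁺) , ∂-minimal m e

  ∂̃-swap : ∂̃ x y ≡ h → ∂̃ y x ≡ h *
  ∂̃-swap = cong _*

  ∂̃≢1,0 : ∂̃ x y ≢ (1 , 0)
  ∂̃≢1,0 e with ∂≡0⇒≡ (cong proj₂ e)
  ... | refl = ∂≡suc⇒≢ (cong proj₁ e) refl

  cnt≢0⇒∃ : cnt x y i j ≢ 0 → ∃[ z ] ∂̃ x z ≡ i × ∂̃ z y ≡ j
  cnt≢0⇒∃ {x} {y} {i} {j} c≢0
    with z , t ← indicatorSum≢0⇒∃ (λ z → (∂̃ x z =ᵖ i) ∧ (∂̃ z y =ᵖ j)) (allFin n) c≢0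
    with a , b ← Equivalence.to T-∧ (Equivalence.from T-≡ t)
    = z , =ᵖ⇒≡ (Equivalence.to T-≡ a) , =ᵖ⇒≡ (Equivalence.to T-≡ b)

  ∃⇒cnt≢0 : ∂̃ x z ≡ i → ∂̃ z y ≡ j → cnt x y i j ≢ 0
  ∃⇒cnt≢0 {x} {z} {i} {y} {j} xz zy =
    ∈⇒indicatorSum≢0 (λ z → (∂̃ x z =ᵖ i) ∧ (∂̃ z y =ᵖ j)) (allFin n) (∈-allFin z)
      (Equivalence.to T-≡ (Equivalence.from T-∧
        (Equivalence.from T-≡ (≡⇒=ᵖ xz) , Equivalence.from T-≡ (≡⇒=ᵖ zy))))

  cnt≡kAt⇒∀ : cnt x y i j ≡ kAt x i → ∂̃ x z ≡ i → ∂̃ z y ≡ j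
  cnt≡kAt⇒∀ {x} {y} {i} {j} {z} c≡k xz = =ᵖ⇒≡
    (indicatorSum-∧-≡⇒ (λ z → ∂̃ x z =ᵖ i) (λ z → ∂̃ z y =ᵖ j) (allFin n) c≡k (∈-allFin z) (≡⇒=ᵖ xz))

  kAt≢0⇒∃ : kAt x i ≢ 0 → ∃[ z ] ∂̃ x z ≡ i
  kAt≢0⇒∃ {x} {i} k≢0 with z , t ← indicatorSum≢0⇒∃ (λ z → ∂̃ x z =ᵖ i) (allFin n) k≢0 = z , =ᵖ⇒≡ t

  pAux≢0⇒∃ : ∀ L → pAux h i j L ≢ 0 → ∃[ x ] ∃[ y ] ∂̃ x y ≡ h × cnt x y i j ≢ 0
  pAux≢0⇒∃ []             p≢0 = ⊥-elim (p≢0 refl)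
  pAux≢0⇒∃ {h} ((x , y) ∷ L) p≢0 with ∂̃ x y =ᵖ h in e
  ... | true  = x , y , =ᵖ⇒≡ e , p≢0
  ... | false = pAux≢0⇒∃ L p≢0

  p≢0⇒triangle : p h i j ≢ 0 → ∃[ x ] ∃[ y ] ∃[ z ] ∂̃ x y ≡ h × ∂̃ x z ≡ i × ∂̃ z y ≡ j
  p≢0⇒triangle {h} {i} {j} p≢0
    with x , y , xy , c≢0 ← pAux≢0⇒∃ (cartesianProduct (allFin n) (allFin n)) p≢0
    with z , xz , zy ← cnt≢0⇒∃ c≢0
    = x , y , z , xy , xz , zy

  p-1,0≡0 : ∀ h j → p h (1 , 0) j ≡ 0
  p-1,0≡0 h j with p h (1 , 0) j ≟ 0
  ... | yes p≡0 = p≡0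
  ... | no  p≢0 with _ , _ , _ , _ , xz , _ ← p≢0⇒triangle {h} {1 , 0} {j} p≢0 = ⊥-elim (∂̃≢1,0 xz)

  module _ (wdr : WeaklyDistanceRegular) where

    pAux≡cnt : ∀ L → (x , y) ∈ L → ∂̃ x y ≡ h → pAux h i j L ≡ cnt x y i j
    pAux≡cnt {x} {y} {h} {i} {j} ((x′ , y′) ∷ L) xy∈ xy with ∂̃ x′ y′ =ᵖ h in e
    ... | true  = wdr x′ y′ x y (trans (=ᵖ⇒≡ e) (sym xy)) i j
    pAux≡cnt ((x′ , y′) ∷ L) (here refl)  xy | false with trans (sym e) (≡⇒=ᵖ xy)
    ... | ()
    pAux≡cnt ((x′ , y′) ∷ L) (there xy∈) xy | false = pAux≡cnt L xy∈ xy

    p≡cnt : ∂̃ x y ≡ h → p h i j ≡ cnt x y i j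
    p≡cnt {x} {y} = pAux≡cnt _ (∈-cartesianProduct⁺ (∈-allFin x) (∈-allFin y))

    p≢0⇒∃ : p h i j ≢ 0 → ∂̃ x y ≡ h → ∃[ z ] ∂̃ x z ≡ i × ∂̃ z y ≡ j
    p≢0⇒∃ p≢0 xy = cnt≢0⇒∃ (p≢0 ∘ trans (p≡cnt xy))

    ∃⇒p≢0 : ∂̃ x y ≡ h → ∂̃ x z ≡ i → ∂̃ z y ≡ j → p h i j ≢ 0
    ∃⇒p≢0 xy xz zy = ∃⇒cnt≢0 xz zy ∘ trans (sym (p≡cnt xy))

    p≡kAt⇒∀ : p h i j ≡ kAt x i → ∂̃ x y ≡ h → ∂̃ x z ≡ i → ∂̃ z y ≡ j
    p≡kAt⇒∀ p≡k xy = cnt≡kAt⇒∀ (trans (sym (p≡cnt xy)) p≡k)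

    p≢0-transpose : p h i j ≢ 0 → p i h (j *) ≢ 0
    p≢0-transpose {h} {i} {j} p≢0 with x , y , z , xy , xz , zy ← p≢0⇒triangle {h} {i} {j} p≢0 =
      ∃⇒p≢0 xz xy (∂̃-swap zy)

    module _ (thick : Thick) where

      thick-square : p h i i ≢ 0 → ∀ x → p h i i ≡ kAt x i
      thick-square {h} {i} p≢0 x with proj₁ (thick x h i)
      ... | inj₁ p≡0 = ⊥-elim (p≢0 p≡0)
      ... | inj₂ p≡k = p≡k

      thick-inverse : p h i (i *) ≢ 0 → ∀ x → p h i (i *) ≡ kAt x i
      thick-inverse {h} {i} p≢0 x with proj₂ (thick x h i)
      ... | inj₁ p≡0 = ⊥-elim (p≢0 p≡0)
      ... | inj₂ p≡k = p≡k

      thick-square-∀ : p h i i ≢ 0 → ∂̃ x y ≡ h → ∂̃ x z ≡ i → ∂̃ z y ≡ i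
      thick-square-∀ {h} {i} {x} p≢0 = p≡kAt⇒∀ (thick-square {h} {i} p≢0 x)

      thick-inverse-∀ : p h i (i *) ≢ 0 → ∂̃ x y ≡ h → ∂̃ x z ≡ i → ∂̃ z y ≡ i *
      thick-inverse-∀ {h} {i} {x} p≢0 = p≡kAt⇒∀ (thick-inverse {h} {i} p≢0 x)

      Γ-nonempty : ∂̃ x y ≡ i → ∃[ w ] ∂̃ y w ≡ i
      Γ-nonempty {x} {y} {i} xy = kAt≢0⇒∃ (p≢0 ∘ trans (thick-inverse {0 , 0} {i} p≢0 y))
        where
        p≢0 : p (0 , 0) i (i *) ≢ 0
        p≢0 = ∃⇒p≢0 (cong₂ _,_ ∂-refl ∂-refl) xy (∂̃-swap xy)

module ArcSquare {n : ℕ} (A : Fin n → Fin n → Bool) (r : ℕ)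
  (wdr : Digraph.WeaklyDistanceRegular A) (thick : Digraph.Thick A)
  (p-ij≢0 : Digraph.p A (1 , 2 + r) (1 , 1 + r) (1 + r , 1) ≢ 0) where
  open Digraph A
  open DigraphProperties A
  open ≤-Reasoning

  -- With q = r + 3 these are the types (1,q-1), (1,q-2), (2,q-2) and (2,q-1).
  i j h₁ h₂ : ℕ × ℕ
  i  = (1 , 2 + r)
  j  = (1 , 1 + r)
  h₁ = (2 , 1 + r)
  h₂ = (2 , 2 + r)

  private
    variable
      x y z u v w : Vertex
      t : ℕ × ℕ

  Γⱼ-shared : ∂̃ x y ≡ i → ∂̃ x z ≡ j → ∂̃ y z ≡ j
  Γⱼ-shared xy xz = ∂̃-swap (thick-inverse-∀ wdr thick {h = i} {i = j} p-ij≢0 xy xz)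

  Γⱼ-nonempty : ∂̃ x y ≡ i → ∃[ z ] ∂̃ x z ≡ j
  Γⱼ-nonempty xy with z , xz , _ ← p≢0⇒∃ wdr {h = i} {i = j} {j = j *} p-ij≢0 xy = z , xz

  two-step-path : ∃[ x ] ∃[ y ] ∃[ w ] ∂̃ x y ≡ i × ∂̃ y w ≡ i
  two-step-path with x , y , _ , xy , _ ← p≢0⇒triangle {i} {j} {j *} p-ij≢0
    with w , yw ← Γ-nonempty wdr thick xy = x , y , w , xy , yw

  module TwoStep (xy : ∂̃ x y ≡ i) (yw : ∂̃ y w ≡ i) where

    forth-≤ : ∂ x w ≤ 2
    forth-≤ = begin
      ∂ x w          ≤⟨ ∂-triangle x y w ⟩
      ∂ x y + ∂ y w  ≡⟨ cong₂ _+_ (cong proj₁ xy) (cong proj₁ yw) ⟩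
      2              ∎

    back-≤ : ∂ w x ≤ 2 + r
    back-≤ with z , xz ← Γⱼ-nonempty xy = begin
      ∂ w x          ≤⟨ ∂-triangle w z x ⟩
      ∂ w z + ∂ z x  ≡⟨ cong₂ _+_ (cong proj₁ (Γⱼ-shared yw (Γⱼ-shared xy xz))) (cong proj₂ xz) ⟩
      2 + r          ∎

    back-≥ : 1 + r ≤ ∂ w x
    back-≥ = s≤s⁻¹ (begin
      2 + r          ≡⟨ cong proj₂ xy ⟨
      ∂ y x          ≤⟨ ∂-triangle y w x ⟩
      ∂ y w + ∂ w x  ≡⟨ cong (_+ ∂ w x) (cong proj₁ yw) ⟩
      1 + ∂ w x      ∎)

    back≡ : ∂ w x ≡ 1 + r ⊎ ∂ w x ≡ 2 + r
    back≡ with m≤n⇒m<n∨m≡n back-≤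
    ... | inj₁ back<2+r = inj₁ (≤-antisym (s≤s⁻¹ back<2+r) back-≥)
    ... | inj₂ back≡2+r = inj₂ back≡2+r

    x≢w : x ≢ w
    x≢w refl with trans (sym (cong proj₁ yw)) (cong proj₂ xy)
    ... | ()

    forth≡2 : ∂ x w ≢ 1 → ∂ x w ≡ 2
    forth≡2 forth≢1 with ∂ x w in forth | forth-≤
    ... | 0                 | _ = ⊥-elim (x≢w (∂≡0⇒≡ forth))
    ... | 1                 | _ = ⊥-elim (forth≢1 refl)
    ... | 2                 | _ = refl
    ... | suc (suc (suc _)) | s≤s (s≤s ())

    two-step-type : ∂̃ x w ≡ h₁ ⊎ ∂̃ x w ≡ h₂
    two-step-type with back≡
    ... | inj₁ back≡1+r = inj₁ (cong₂ _,_ (forth≡2 forth≢1) back≡1+r)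
      where
      forth≢1 : ∂ x w ≢ 1
      forth≢1 forth≡1 = 1+n≢n (trans (sym (cong proj₂ yw)) (cong proj₂ yw′))
        where yw′ = Γⱼ-shared xy (cong₂ _,_ forth≡1 back≡1+r)
    ... | inj₂ back≡2+r = inj₂ (cong₂ _,_ (forth≡2 forth≢1) back≡2+r)
      where
      -- Otherwise p^i_{i,i} ≠ 0, and thickness would force y ∈ Γ_i(y).
      forth≢1 : ∂ x w ≢ 1
      forth≢1 forth≡1 = ∂≡suc⇒≢ (cong proj₁ yy) refl
        where
        xw = cong₂ _,_ forth≡1 back≡2+r
        yy = thick-square-∀ wdr thick (∃⇒p≢0 wdr xw xy yw) xy xy

  open TwoStep using (two-step-type)

  geodesic-type : ∂̃ x y ≡ i → ∂̃ v y ≡ i * → ∂ v u ≤ 1 → ∂ u x ≤ r → ∂̃ y u ≡ h₁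
  geodesic-type {x} {y} {v} {u} xy vy vu ux =
    cong₂ _,_ (≤-antisym yu-≤ yu-≥) (≤-antisym uy-≤ uy-≥)
    where
    yu-≤ : ∂ y u ≤ 2
    yu-≤ = begin
      ∂ y u          ≤⟨ ∂-triangle y v u ⟩
      ∂ y v + ∂ v u  ≤⟨ +-mono-≤ (≤-reflexive (cong proj₂ vy)) vu ⟩
      2              ∎
    yu-≥ : 2 ≤ ∂ y u
    yu-≥ = +-cancelʳ-≤ r 2 (∂ y u) (begin
      2 + r          ≡⟨ cong proj₂ xy ⟨
      ∂ y x          ≤⟨ ∂-triangle y u x ⟩
      ∂ y u + ∂ u x  ≤⟨ +-monoʳ-≤ (∂ y u) ux ⟩
      ∂ y u + r      ∎)
    uy-≤ : ∂ u y ≤ 1 + r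
    uy-≤ = begin
      ∂ u y          ≤⟨ ∂-triangle u x y ⟩
      ∂ u x + ∂ x y  ≤⟨ +-mono-≤ ux (≤-reflexive (cong proj₁ xy)) ⟩
      r + 1          ≡⟨ +-comm r 1 ⟩
      1 + r          ∎
    uy-≥ : 1 + r ≤ ∂ u y
    uy-≥ = s≤s⁻¹ (begin
      2 + r          ≡⟨ cong proj₁ vy ⟨
      ∂ v y          ≤⟨ ∂-triangle v u y ⟩
      ∂ v u + ∂ u y  ≤⟨ +-monoˡ-≤ (∂ u y) vu ⟩
      1 + ∂ u y      ∎)

  -- The vertex u after v on a geodesic from v to x has ∂̃(y,u) = h₁, so by thickness
  -- every w ∈ Γ_i(y) is an in-neighbour of u.
  h₁-witness⇒back-≤ : p h₁ i i ≢ 0 → ∂̃ x y ≡ i → ∂̃ y w ≡ i → ∂̃ x v ≡ h₁ → ∂̃ v y ≡ i * →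
                      ∂ w x ≤ 1 + r
  h₁-witness⇒back-≤ {x} {y} {w} p≢0 xy yw xv vy
    with u , vu , ux ← ∂-geodesic (cong proj₂ xv)
                         (≤-trans (≤-reflexive (trans (cong suc (cong proj₂ xv)) (sym (cong proj₂ xy)))) ∂-≤-bound)
    = begin
      ∂ w x          ≤⟨ ∂-triangle w u x ⟩
      ∂ w u + ∂ u x  ≤⟨ +-mono-≤ (≤-reflexive (cong proj₁ wu)) ux ⟩
      1 + r          ∎
    where wu = thick-square-∀ wdr thick p≢0 (geodesic-type xy vy vu ux) yw

  h₁∈Γᵢ²⇒back-≤ : p h₁ i i ≢ 0 → ∂̃ x y ≡ i → ∂̃ y w ≡ i → ∂ w x ≤ 1 + r
  h₁∈Γᵢ²⇒back-≤ p≢0 xy yw =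
    let v , xv , vy = p≢0⇒∃ wdr {h = i} {i = h₁} {j = i *} (p≢0-transpose wdr {h₁} {i} {i} p≢0) xy
    in h₁-witness⇒back-≤ p≢0 xy yw xv vy

  two-step-h₁ : p h₁ i i ≢ 0 → ∂̃ x y ≡ i → ∂̃ y w ≡ i → ∂̃ x w ≡ h₁
  two-step-h₁ p₁≢0 xy yw with two-step-type xy yw
  ... | inj₁ xw≡h₁ = xw≡h₁
  ... | inj₂ xw≡h₂ =
    ⊥-elim (1+n≰n (≤-trans (≤-reflexive (sym (cong proj₂ xw≡h₂))) (h₁∈Γᵢ²⇒back-≤ p₁≢0 xy yw)))

  two-step-h₂ : p h₁ i i ≡ 0 → ∂̃ x y ≡ i → ∂̃ y w ≡ i → ∂̃ x w ≡ h₂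
  two-step-h₂ p₁≡0 xy yw with two-step-type xy yw
  ... | inj₁ xw≡h₁ = ⊥-elim (∃⇒p≢0 wdr xw≡h₁ xy yw p₁≡0)
  ... | inj₂ xw≡h₂ = xw≡h₂

  two-step⇒square : (∀ {x y w} → ∂̃ x y ≡ i → ∂̃ y w ≡ i → ∂̃ x w ≡ t) → SquareIs i t
  two-step⇒square {t} type h = mk⇔ h∈Γᵢ²⇒≡ (λ { refl → t∈Γᵢ² })
    where
    h∈Γᵢ²⇒≡ : p h i i ≢ 0 → h ≡ t
    h∈Γᵢ²⇒≡ p≢0 with x , w , y , xw , xy , yw ← p≢0⇒triangle {h} {i} {i} p≢0 =
      trans (sym xw) (type xy yw)
    t∈Γᵢ² : p t i i ≢ 0
    t∈Γᵢ² with x , y , w , xy , yw ← two-step-path = ∃⇒p≢0 wdr (type xy yw) xy yw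

  theorem : SquareIs i h₁ ⊎ SquareIs i h₂
  theorem with p h₁ i i ≟ 0
  ... | no  p₁≢0 = inj₁ (two-step⇒square (two-step-h₁ p₁≢0))
  ... | yes p₁≡0 = inj₂ (two-step⇒square (two-step-h₂ p₁≡0))

-- For q ≤ 2 the truncated subtraction turns
-- the hypothesis into p^{(1,q-1)}_{(1,0),(0,1)} ≠ 0, which fails since Γ_{1,0} is empty.
lemma2p7 : (n : ℕ) (A : Fin n → Fin n → Bool) (q : ℕ) →
    Digraph.Simple A → Digraph.StronglyConnected A →
    Digraph.WeaklyDistanceRegular A → Digraph.Commutative A → Digraph.Thick A →
    Digraph.D A q →
    Digraph.SquareIs A (1 , q ∸ 1) (2 , q ∸ 2) ⊎ Digraph.SquareIs A (1 , q ∸ 1) (2 , q ∸ 1)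
lemma2p7 n A 0 _ _ _ _ _ (p≢0 , _) = ⊥-elim (p≢0 (DigraphProperties.p-1,0≡0 A _ _))
lemma2p7 n A 1 _ _ _ _ _ (p≢0 , _) = ⊥-elim (p≢0 (DigraphProperties.p-1,0≡0 A _ _))
lemma2p7 n A 2 _ _ _ _ _ (p≢0 , _) = ⊥-elim (p≢0 (DigraphProperties.p-1,0≡0 A _ _))
lemma2p7 n A (suc (suc (suc r))) _ _ wdr _ thick (p≢0 , _) = ArcSquare.theorem A r wdr thick p≢0
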